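{- For every integer $a\geq1$, $$B_{a+1}=\bigl(C_a\cap E_a(B_1)\bigr)\cup\bigl(B_a\cap E_a(C_1)\bigr),\qquad C_{a+1}=\bigl(C_a\cap E_a(C_1)\bigr)\cup\bigl(B_a\cap E_a(B_1)\bigr).$$
   Context: $\mathbb{N}_0=\{0,1,2,\dots\}$. $t(n)$ is the Thue–Morse sequence: $t(n)=0$ if the binary expansion of $n$ has an even number of $1$'s, $t(n)=1$ otherwise. For $a\ge1$, $B_a=\{x\in\mathbb{N}_0: t(x+a)=1-t(x)\}$ and $C_a=\{x\in\mathbb{N}_0: t(x+a)=t(x)\}$. For a set of integers $A$ and $h\in\mathbb{Z}$, $E_h(A)=\{y-h: y\in A\}$. -}

module Defs where

open import Data.Nat using (ℕ; zero; suc; _+_; _/_; _%_)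
open import Data.Integer as ℤ using (ℤ; +_; _-_)
open import Data.Bool using (Bool; true; false; not; _xor_)
open import Data.Product using (Σ; _×_; _,_)
open import Data.Sum using (_⊎_)
open import Relation.Binary.PropositionalEquality using (_≡_)
open import Level using (0ℓ)
open import Relation.Unary using (Pred)
open import Function.Bundles using (_⇔_)
open import Induction.WellFounded using (Acc; acc)
open import Data.Nat.Induction using (<-wellFounded)
open import Data.Nat.DivMod using (m/n<m)
open import Data.Nat using (_<_; _≤_; s≤s; z≤n)

-- Thue–Morse: t(n) = parity of the number of 1's in binary expansion of n,
-- with true = 1, false = 0.  Computed via t(0)=0, t(n)=t(n/2) xor (n mod 2).
parityBit : ℕ → Bool
parityBit n with n % 2
... | zero = false
... | suc _ = true

tAcc : (n : ℕ) → Acc _<_ n → Bool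
tAcc zero _ = false
tAcc (suc n) (acc rs) =
  parityBit (suc n) xor tAcc (suc n / 2) (rs (m/n<m (suc n) 2 (s≤s (s≤s z≤n))))

t : ℕ → Bool
t n = tAcc n (<-wellFounded n)

ISet : Set₁
ISet = Pred ℤ 0ℓ

B : ℕ → ISet
B a z = Σ ℕ λ x → (z ≡ + x) × (t (x + a) ≡ not (t x))

C : ℕ → ISet
C a z = Σ ℕ λ x → (z ≡ + x) × (t (x + a) ≡ t x)

E : ℤ → ISet → ISet
E h A z = Σ ℤ λ y → A y × (z ≡ y - h)

_∩_ : ISet → ISet → ISet
(A ∩ A') z = A z × A' z

_∪_ : ISet → ISet → ISet
(A ∪ A') z = A z ⊎ A' z

infixr 7 _∩_
infixr 6 _∪_

_≐_ : ISet → ISet → Set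
A ≐ A' = ∀ z → A z ⇔ A' z

infix 4 _≐_

module Submission where

-- The recursions for B_{a+1} and C_{a+1} use nothing about the Thue–Morse
-- sequence beyond t being a function ℕ → Bool: at a point x, with
-- p = t(x), q = t(x+a), r = t(x+a+1), the condition "r ≠ p" (x ∈ B_{a+1})
-- holds iff either q = p and r ≠ q (x ∈ C_a and x+a ∈ B_1) or q ≠ p and
-- r = q (x ∈ B_a and x+a ∈ C_1); similarly for "r = p".
--
-- The theorem then follows by rewriting both sides at a point + x.

open import Defs
open import Data.Nat using (ℕ; suc; _≥_)
open import Data.Integer using (+_)
import Data.Nat as ℕ
import Data.Nat.Properties as ℕP
import Data.Integer as ℤ
import Data.Integer.Properties as ℤP
open import Algebra.Bundles using (AbelianGroup)
open import Algebra.Properties.Group (AbelianGroup.group ℤP.+-0-abelianGroup) using (//-rightDividesˡ; //-rightDividesʳ)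
open import Data.Bool using (Bool; true; false; not)
open import Data.Empty using (⊥-elim)
open import Data.Product using (Σ; _×_; _,_; proj₂)
open import Data.Sum using (_⊎_; inj₁; inj₂; [_,_])
open import Data.Product.Function.NonDependent.Propositional using (_×-⇔_)
open import Data.Sum.Function.Propositional using (_⊎-⇔_)
open import Function using (_∘_)
open import Function.Bundles using (_⇔_; mk⇔; Equivalence)
open import Function.Properties.Equivalence using (⇔-setoid) renaming (trans to ⇔-trans)
open import Level using (0ℓ)
open import Relation.Nullary using (¬_)
open import Relation.Binary.PropositionalEquality using (_≡_; refl; sym; trans; cong; subst)
open import Relation.Binary.Reasoning.Setoid (⇔-setoid 0ℓ)

Natural : ISet → Set
Natural A = ∀ {z} → A z → Σ ℕ λ x → z ≡ + x

≐-on-ℕ : ∀ {A A′ : ISet} → Natural A → Natural A′ →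
         (∀ x → A (+ x) ⇔ A′ (+ x)) → A ≐ A′
≐-on-ℕ {A} {A′} natA natA′ agree z = mk⇔ forward backward
  where
  forward : A z → A′ z
  forward Az with natA Az
  ... | x , refl = Equivalence.to (agree x) Az

  backward : A′ z → A z
  backward A′z with natA′ A′z
  ... | x , refl = Equivalence.from (agree x) A′z

ℕ-image : (ℕ → Set) → ISet
ℕ-image R z = Σ ℕ λ x → (z ≡ + x) × R x

ℕ-image-natural : ∀ R → Natural (ℕ-image R)
ℕ-image-natural R (x , z≡x , _) = x , z≡x

∩-natural : ∀ {A} A′ → Natural A → Natural (A ∩ A′)
∩-natural _ natA (Az , _) = natA Az

∪-natural : ∀ {A A′} → Natural A → Natural A′ → Natural (A ∪ A′)
∪-natural natA natA′ = [ natA , natA′ ]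

ℕ-image-at : ∀ R x → ℕ-image R (+ x) ⇔ R x
ℕ-image-at R x = mk⇔ satisfies (λ Rx → x , refl , Rx)
  where
  satisfies : ℕ-image R (+ x) → R x
  satisfies (y , x≡y , Ry) = subst R (sym (ℤP.+-injective x≡y)) Ry

B-at : ∀ a x → B a (+ x) ⇔ (t (x ℕ.+ a) ≡ not (t x))
B-at a = ℕ-image-at (λ y → t (y ℕ.+ a) ≡ not (t y))

C-at : ∀ a x → C a (+ x) ⇔ (t (x ℕ.+ a) ≡ t x)
C-at a = ℕ-image-at (λ y → t (y ℕ.+ a) ≡ t y)

E-at : ∀ (A : ISet) a x → E (+ a) A (+ x) ⇔ A (+ (x ℕ.+ a))
E-at A a x = mk⇔ unshift (λ Ax+a → + (x ℕ.+ a) , Ax+a , sym (//-rightDividesʳ (+ a) (+ x)))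
  where
  -- y = (y - a) + a = x + a in the additive group ℤ.
  unshift : E (+ a) A (+ x) → A (+ (x ℕ.+ a))
  unshift (y , Ay , x≡y-a) = subst A y≡x+a Ay
    where
    y≡x+a : y ≡ + x ℤ.+ + a
    y≡x+a = trans (sym (//-rightDividesˡ (+ a) y)) (cong (ℤ._+ + a) (sym x≡y-a))

agreeing : ∀ {b : Bool} {P Q : Set} → ¬ Q → P ⇔ ((b ≡ b × P) ⊎ Q)
agreeing ¬Q = mk⇔ (λ p → inj₁ (refl , p)) [ proj₂ , ⊥-elim ∘ ¬Q ]

disagreeing : ∀ {b : Bool} {P Q : Set} → ¬ Q → P ⇔ (Q ⊎ (b ≡ b × P))
disagreeing ¬Q = mk⇔ (λ p → inj₂ (refl , p)) [ ⊥-elim ∘ ¬Q , proj₂ ]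

flip-via : ∀ p q r →
  (r ≡ not p) ⇔ ((q ≡ p × r ≡ not q) ⊎ (q ≡ not p × r ≡ q))
flip-via false false _ = agreeing λ { (() , _) }
flip-via false true  _ = disagreeing λ { (() , _) }
flip-via true  false _ = disagreeing λ { (() , _) }
flip-via true  true  _ = agreeing λ { (() , _) }

keep-via : ∀ p q r →
  (r ≡ p) ⇔ ((q ≡ p × r ≡ q) ⊎ (q ≡ not p × r ≡ not q))
keep-via false false _ = agreeing λ { (() , _) }
keep-via false true  _ = disagreeing λ { (() , _) }
keep-via true  false _ = disagreeing λ { (() , _) }
keep-via true  true  _ = agreeing λ { (() , _) }

E-B₁-at : ∀ a x → E (+ a) (B 1) (+ x) ⇔ (t (x ℕ.+ a ℕ.+ 1) ≡ not (t (x ℕ.+ a)))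
E-B₁-at a x = ⇔-trans (E-at (B 1) a x) (B-at 1 (x ℕ.+ a))

E-C₁-at : ∀ a x → E (+ a) (C 1) (+ x) ⇔ (t (x ℕ.+ a ℕ.+ 1) ≡ t (x ℕ.+ a))
E-C₁-at a x = ⇔-trans (E-at (C 1) a x) (C-at 1 (x ℕ.+ a))

t-reindex : ∀ x a {v : Bool} → (t (x ℕ.+ suc a) ≡ v) ⇔ (t (x ℕ.+ a ℕ.+ 1) ≡ v)
t-reindex x a = mk⇔ (trans (sym same)) (trans same)
  where
  same : t (x ℕ.+ suc a) ≡ t (x ℕ.+ a ℕ.+ 1)
  same = cong t (trans (ℕP.+-suc x a) (ℕP.+-comm 1 (x ℕ.+ a)))

theorem3 : (a : ℕ) → a ≥ 1 →
    (B (suc a) ≐ (C a ∩ E (+ a) (B 1)) ∪ (B a ∩ E (+ a) (C 1)))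
    × (C (suc a) ≐ (C a ∩ E (+ a) (C 1)) ∪ (B a ∩ E (+ a) (B 1)))
theorem3 a _ = ≐-on-ℕ (ℕ-image-natural _) (rhs-natural (E (+ a) (B 1)) (E (+ a) (C 1))) B-step
             , ≐-on-ℕ (ℕ-image-natural _) (rhs-natural (E (+ a) (C 1)) (E (+ a) (B 1))) C-step
  where
  rhs-natural : ∀ X Y → Natural ((C a ∩ X) ∪ (B a ∩ Y))
  rhs-natural X Y = ∪-natural (∩-natural X (ℕ-image-natural _)) (∩-natural Y (ℕ-image-natural _))

  B-step : ∀ x → B (suc a) (+ x) ⇔ ((C a ∩ E (+ a) (B 1)) ∪ (B a ∩ E (+ a) (C 1))) (+ x)
  B-step x = begin
    B (suc a) (+ x)                              ≈⟨ ⇔-trans (B-at (suc a) x) (t-reindex x a) ⟩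
    (r ≡ not p)                                  ≈⟨ flip-via p q r ⟩
    ((q ≡ p × r ≡ not q) ⊎ (q ≡ not p × r ≡ q))  ≈⟨ (C-at a x ×-⇔ E-B₁-at a x) ⊎-⇔ (B-at a x ×-⇔ E-C₁-at a x) ⟨
    ((C a ∩ E (+ a) (B 1)) ∪ (B a ∩ E (+ a) (C 1))) (+ x) ∎
    where
    p q r : Bool
    p = t x
    q = t (x ℕ.+ a)
    r = t (x ℕ.+ a ℕ.+ 1)

  C-step : ∀ x → C (suc a) (+ x) ⇔ ((C a ∩ E (+ a) (C 1)) ∪ (B a ∩ E (+ a) (B 1))) (+ x)
  C-step x = begin
    C (suc a) (+ x)                              ≈⟨ ⇔-trans (C-at (suc a) x) (t-reindex x a) ⟩
    (r ≡ p)                                      ≈⟨ keep-via p q r ⟩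
    ((q ≡ p × r ≡ q) ⊎ (q ≡ not p × r ≡ not q))  ≈⟨ (C-at a x ×-⇔ E-C₁-at a x) ⊎-⇔ (B-at a x ×-⇔ E-B₁-at a x) ⟨
    ((C a ∩ E (+ a) (C 1)) ∪ (B a ∩ E (+ a) (B 1))) (+ x) ∎
    where
    p q r : Bool
    p = t x
    q = t (x ℕ.+ a)
    r = t (x ℕ.+ a ℕ.+ 1)
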